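{- Let $F=(f_1,f_2,\dots)$ be a sequence of functions with $f_i\in F_i$ for every $i\ge1$ and $f_i(k)\le f_{i+1}(k)$ for all $i\ge1$ and $1\le k\le i$. Then for every positive integer $m$, the rooted tree $Tree_m^F$ is strongly $m$-universal for the class of rooted trees.
   Context: For a positive integer $p$, $F_p$ is the set of functions $f:\{1,\dots,p\}\to\{0,1,\dots,\lfloor p/2\rfloor\}$ such that for every $n\in\{1,\dots,p\}$ and every integer $1\le i\le\lfloor n/2\rfloor$ there exists an integer $k$ with $n-i+1\le k\le n$ and $f(k)\ge i$. A rooted tree is a tree with a distinguished vertex, the root. For rooted trees $T_1,\dots,T_k$ (possibly empty, taken as disjoint copies), $[T_1,\dots,T_k]$ is the rooted tree obtained from a path $v_1v_2\cdots v_{k+1}$ (with $k$ edges) by adding, for each $j$ with $T_j$ nonempty, the tree $T_j$ and the edge $\{v_j,r(T_j)\}$ where $r(T_j)$ is the root of $T_j$; its root is $v_1$. Define rooted trees $T_n$ for $n\ge -1$ by: $T_{ -1}=\emptyset$ (empty tree), $T_0$ a single vertex, and for $n\ge1$, $T_n=[T_{\min(f_n(n)-1,\,n-1)},\,T_{\min(f_n(n-1)-1,\,n-1)},\,\dots,\,T_{\min(f_n(1)-1,\,n-1)}]$ (the $j$-th entry is $T_{\min(f_n(n+1-j)-1,\,n-1)}$). Then $Tree_m^F:=T_m$. A rooted contraction of a rooted tree $T$ is a rooted tree obtained from $T$ by successively contracting edges, the root of the result being the image of the root of $T$. A rooted tree $U$ is strongly $m$-universal for the class of rooted trees if every rooted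 tree with $m$ edges is a rooted contraction of $U$. -}

module Defs where

open import Data.Nat using (ℕ; zero; suc; _+_; _∸_; _≤_; _/_; _⊓_; s≤s)
open import Data.Nat.Properties using (m⊓n≤n)
open import Data.List using (List; []; _∷_; _++_; map; downFrom)
open import Data.Maybe using (Maybe; nothing; just)
open import Data.Vec using (Vec; []; _∷_; _∷ʳ_; lookup)
open import Data.Fin using (Fin; fromℕ; fromℕ<)
open import Data.Product using (Σ; _×_; ∃)
open import Relation.Binary.PropositionalEquality using (_≡_)
open import Relation.Binary.Construct.Closure.ReflexiveTransitive using (Star)

-- Rooted trees (unordered, up to isomorphism) as rose trees; the order
-- of children is irrelevant because isomorphism (child swaps) is built
-- into the contraction relation below.

data RTree : Set where
  node : List RTree → RTree

mutual
  edges : RTree → ℕ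
  edges (node ts) = edgesL ts

  edgesL : List RTree → ℕ
  edgesL [] = 0
  edgesL (t ∷ ts) = suc (edges t + edgesL ts)

leaf : RTree
leaf = node []

maybeToList : Maybe RTree → List RTree
maybeToList nothing = []
maybeToList (just t) = t ∷ []

-- [T_1,…,T_k] : path v_1 … v_{k+1}, T_j (if nonempty) hung below v_j, root v_1.
bracket : List (Maybe RTree) → RTree
bracket [] = leaf
bracket (mt ∷ mts) = node (maybeToList mt ++ (bracket mts ∷ []))

-- One step: contract the edge from a vertex to one of its children,
-- swap two adjacent children (generates rooted isomorphisms), or do a
-- step inside a subtree.

data Step : RTree → RTree → Set where
  contract : ∀ ts us vs →
    Step (node (ts ++ node us ∷ vs)) (node (ts ++ us ++ vs))
  swap : ∀ ts a b vs →
    Step (node (ts ++ a ∷ b ∷ vs)) (node (ts ++ b ∷ a ∷ vs))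
  deep : ∀ ts {t t'} vs → Step t t' →
    Step (node (ts ++ t ∷ vs)) (node (ts ++ t' ∷ vs))

_⊒_ : RTree → RTree → Set
U ⊒ T = Star Step U T

StronglyUniversal : ℕ → RTree → Set
StronglyUniversal m U = ∀ (T : RTree) → edges T ≡ m → U ⊒ T

-- The class F_p.  A function {1,…,p} → {0,…,⌊p/2⌋} is represented by
-- f : ℕ → ℕ; only its values on 1,…,p matter.

InF : ℕ → (ℕ → ℕ) → Set
InF p f =
  (∀ k → 1 ≤ k → k ≤ p → f k ≤ p / 2) ×
  (∀ n → 1 ≤ n → n ≤ p → ∀ i → 1 ≤ i → i ≤ n / 2 →
     ∃ λ k → (n ∸ i + 1 ≤ k) × (k ≤ n) × (i ≤ f k))

-- A sequence F = (f_1,f_2,…) is given as F : ℕ → ℕ → ℕ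
-- with F i = f_i (F 0 unused).  table F n = (T_0, …, T_n).
-- Entry for T_{n+1} at position j is T_{min(f(k)-1, n)} with
-- k = n+2-j, which is empty iff f(k) = 0.

private
  clamp : ∀ n → ℕ → Fin (suc n)
  clamp n x = fromℕ< (s≤s (m⊓n≤n x n))

entry : ∀ n → Vec RTree (suc n) → ℕ → Maybe RTree
entry n tab zero = nothing
entry n tab (suc x) = just (lookup tab (clamp n x))

table : (ℕ → ℕ → ℕ) → (n : ℕ) → Vec RTree (suc n)
table F zero = leaf ∷ []
table F (suc n) =
  table F n ∷ʳ bracket (map (λ k → entry n (table F n) (F (suc n) k))
                            (map suc (downFrom (suc n))))

TreeF : (ℕ → ℕ → ℕ) → ℕ → RTree
TreeF F m = lookup (table F m) (fromℕ m)

-- By induction on N, T_N contracts onto every rooted tree with at most N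
-- edges. Write T_{N+1} = [H_{N+1}, …, H_1] and let S_n = [H_n, …, H_1] be its
-- suffixes; S_n contracts onto S_k for k ≤ n, and we show by strong induction
-- on n that S_n is universal for trees with at most n edges. A root with one
-- child c is reached by discarding H_n and recursing into S_{n-1}. Otherwise
-- let c be a smallest child, with e edges, so 2(e+1) ≤ n; the condition
-- defining F_{N+1} with i = e+1 yields k ∈ [n-e, n] with f(k) ≥ e+1, whence
-- H_k = T_{min(f(k)-1, N)} is universal for e edges and receives c, while the
-- remaining children, with at most n-e-1 ≤ k-1 edges, come from S_{k-1}.
module Submission where

open import Defs
open import Data.Nat using (ℕ; zero; suc; _+_; _*_; _∸_; _≤_; _<_; _≤′_; ≤′-reflexive; ≤′-step; _/_; z≤n; s≤s; s≤s⁻¹)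
open import Data.Nat.Properties
open import Data.Nat.DivMod using (/-monoˡ-≤; m*n/n≡m)
open import Data.Nat.Induction using (<-rec)
open import Algebra.Properties.CommutativeSemigroup +-commutativeSemigroup using (x∙yz≈y∙xz)
open import Data.List using (List; []; _∷_; _++_; map; downFrom)
open import Data.List.Properties using (++-identityʳ)
open import Data.Maybe using (Maybe; nothing; just)
open import Data.Empty using (⊥-elim)
open import Data.Vec using (Vec; []; _∷_; _∷ʳ_; lookup)
open import Data.Fin using (Fin; zero; suc; toℕ; fromℕ)
open import Data.Fin.Properties using (toℕ-fromℕ<; toℕ-fromℕ)
open import Data.Product using (_×_; ∃-syntax; _,_; proj₂)
open import Data.Sum using (inj₁; inj₂)
open import Relation.Binary.PropositionalEquality using (_≡_; refl; sym; trans; cong; subst)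
open Relation.Binary.PropositionalEquality.≡-Reasoning
open import Relation.Binary.Construct.Closure.ReflexiveTransitive using (ε; _◅_; _◅◅_; gmap)

m+m≤n⇒m≤n/2 : ∀ m n → m + m ≤ n → m ≤ n / 2
m+m≤n⇒m≤n/2 m n m+m≤n =
  subst (_≤ n / 2) (m*n/n≡m m 2) (/-monoˡ-≤ 2 (subst (_≤ n) m+m≡m*2 m+m≤n))
  where
  m+m≡m*2 : m + m ≡ m * 2
  m+m≡m*2 = trans (cong (m +_) (sym (+-identityʳ m))) (*-comm 2 m)

lookup-∷ʳ-pointwise : ∀ {A : Set} {n} (P : A → ℕ → Set) (xs : Vec A n) x →
  (∀ i → P (lookup xs i) (toℕ i)) → P x n → ∀ i → P (lookup (xs ∷ʳ x) i) (toℕ i)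
lookup-∷ʳ-pointwise P []       x Pxs Px zero    = Px
lookup-∷ʳ-pointwise P (y ∷ ys) x Pxs Px zero    = Pxs zero
lookup-∷ʳ-pointwise P (y ∷ ys) x Pxs Px (suc i) =
  lookup-∷ʳ-pointwise (λ t j → P t (suc j)) ys x (λ i → Pxs (suc i)) Px i

edgesL-swap : ∀ a b ts → edgesL (a ∷ b ∷ ts) ≡ edgesL (b ∷ a ∷ ts)
edgesL-swap a b ts = cong suc (begin
  edges a + suc (edges b + edgesL ts)  ≡⟨ +-suc (edges a) _ ⟩
  suc (edges a + (edges b + edgesL ts)) ≡⟨ cong suc (x∙yz≈y∙xz (edges a) (edges b) (edgesL ts)) ⟩
  suc (edges b + (edges a + edgesL ts)) ≡⟨ sym (+-suc (edges b) _) ⟩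
  edges b + suc (edges a + edgesL ts)  ∎)

smaller-child-bound : ∀ a b ts {n} → edges a ≤ edges b → edgesL (a ∷ b ∷ ts) ≤ n →
  suc (edges a) + suc (edges a) ≤ n
smaller-child-bound a b ts a≤b size =
  ≤-trans (+-monoʳ-≤ (suc (edges a)) (s≤s (≤-trans a≤b (m≤m+n (edges b) (edgesL ts))))) size

⊒-under : ∀ ts vs {t t'} → t ⊒ t' → node (ts ++ t ∷ vs) ⊒ node (ts ++ t' ∷ vs)
⊒-under ts vs = gmap (λ t → node (ts ++ t ∷ vs)) (deep ts vs)

mutual
  ⊒-leaf : ∀ t → t ⊒ leaf
  ⊒-leaf (node ts) = node-⊒-leaf ts

  node-⊒-leaf : ∀ ts → node ts ⊒ leaf
  node-⊒-leaf []       = ε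
  node-⊒-leaf (t ∷ ts) = ⊒-under [] ts (⊒-leaf t) ◅◅ contract [] [] ts ◅ node-⊒-leaf ts

node-singleton-⊒ : ∀ t → node (t ∷ []) ⊒ t
node-singleton-⊒ (node us) =
  subst (λ vs → node (node us ∷ []) ⊒ node vs) (++-identityʳ us) (contract [] us [] ◅ ε)

bracket-⊒-node-tail : ∀ mt mts → bracket (mt ∷ mts) ⊒ node (bracket mts ∷ [])
bracket-⊒-node-tail nothing mts = ε
bracket-⊒-node-tail (just t) mts = ⊒-under [] _ (⊒-leaf t) ◅◅ contract [] [] _ ◅ ε

bracket-⊒-tail : ∀ mt mts → bracket (mt ∷ mts) ⊒ bracket mts
bracket-⊒-tail mt mts = bracket-⊒-node-tail mt mts ◅◅ node-singleton-⊒ (bracket mts)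

bracket-hang : ∀ H mts c rest → H ⊒ c → bracket mts ⊒ node rest →
  bracket (just H ∷ mts) ⊒ node (c ∷ rest)
bracket-hang H mts c rest H⊒c mts⊒rest =
  ⊒-under [] _ H⊒c ◅◅ ⊒-under (c ∷ []) [] mts⊒rest ◅◅
  subst (λ vs → node (c ∷ node rest ∷ []) ⊒ node (c ∷ vs)) (++-identityʳ rest)
        (contract (c ∷ []) rest [] ◅ ε)

UniversalUpTo : RTree → ℕ → Set
UniversalUpTo U m = ∀ T → edges T ≤ m → U ⊒ T

universalUpTo-0 : ∀ U → UniversalUpTo U 0
universalUpTo-0 U (node []) _ = ⊒-leaf U

module Spine (N : ℕ) (tab : Vec RTree (suc N))
             (tab-universal : ∀ i → UniversalUpTo (lookup tab i) (toℕ i))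
             (f : ℕ → ℕ) (f∈F : InF (suc N) f) where

  entries : ℕ → List (Maybe RTree)
  entries n = map (λ k → entry N tab (f k)) (map suc (downFrom n))

  spine : ℕ → RTree
  spine n = bracket (entries n)

  spine-antitone : ∀ {k n} → k ≤′ n → spine n ⊒ spine k
  spine-antitone (≤′-reflexive refl) = ε
  spine-antitone (≤′-step k≤′n)     = bracket-⊒-tail _ _ ◅◅ spine-antitone k≤′n

  entry-⊒ : ∀ k c → edges c < f k → edges c ≤ N → ∃[ H ] entry N tab (f k) ≡ just H × H ⊒ c
  entry-⊒ k c c<fk c≤N with f k | c<fk
  ... | suc x | s≤s c≤x =
    _ , refl , subst (UniversalUpTo _) (toℕ-fromℕ< _) (tab-universal _) c (⊓-glb c≤x c≤N)

  spine-hang : ∀ k c rest → edges c < f (suc k) → edges c ≤ N → spine k ⊒ node rest →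
    spine (suc k) ⊒ node (c ∷ rest)
  spine-hang k c rest c<f c≤N k⊒rest with entry-⊒ (suc k) c c<f c≤N
  ... | H , eq , H⊒c =
    subst (λ mt → bracket (mt ∷ entries k) ⊒ node (c ∷ rest)) (sym eq)
          (bracket-hang H (entries k) c rest H⊒c k⊒rest)

  hanging-point : ∀ n e → suc e + suc e ≤ n → n ≤ suc N →
    ∃[ k ] n ∸ suc e ≤ k × suc k ≤ n × e < f (suc k)
  hanging-point n e small n≤ with proj₂ f∈F n (≤-trans (s≤s z≤n) small) n≤ (suc e) (s≤s z≤n)
                                          (m+m≤n⇒m≤n/2 (suc e) n small)
  ... | zero  , lo , _  , _  = ⊥-elim (n≮0 (subst (_≤ 0) (+-comm _ 1) lo))
  ... | suc k , lo , hi , e<fk = k , s≤s⁻¹ (subst (_≤ suc k) (+-comm _ 1) lo) , hi , e<fk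

  spine-smallest-child : ∀ n → (∀ {k} → k < n → UniversalUpTo (spine k) k) → n ≤ suc N →
    ∀ c rest → suc (edges c) + suc (edges c) ≤ n → edgesL (c ∷ rest) ≤ n → spine n ⊒ node (c ∷ rest)
  spine-smallest-child n IH n≤ c rest small size with hanging-point n (edges c) small n≤
  ... | k , lo , k<n , c<f =
    spine-antitone (≤⇒≤′ k<n) ◅◅ spine-hang k c rest c<f c≤N (IH k<n (node rest) rest≤k)
    where
    c≤N : edges c ≤ N
    c≤N = s≤s⁻¹ (≤-trans (m≤m+n (suc (edges c)) _) (≤-trans small n≤))
    rest≤k : edgesL rest ≤ k
    rest≤k = ≤-trans (m+n≤o⇒m≤o∸n (edgesL rest) (subst (_≤ n) (+-comm (suc (edges c)) _) size)) lo

  spine-universal : ∀ n → n ≤ suc N → UniversalUpTo (spine n) n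
  spine-universal = <-rec (λ n → n ≤ suc N → UniversalUpTo (spine n) n)
    λ n rec n≤ → universal n (λ k<n → rec k<n (≤-trans (<⇒≤ k<n) n≤)) n≤
    where
    universal : ∀ n → (∀ {k} → k < n → UniversalUpTo (spine k) k) →
      n ≤ suc N → UniversalUpTo (spine n) n
    universal zero    _  _  = universalUpTo-0 (spine 0)
    universal (suc n) IH n≤ (node []) _ = ⊒-leaf (spine (suc n))
    universal (suc n) IH n≤ (node (c ∷ [])) size =
      bracket-⊒-node-tail _ _ ◅◅ ⊒-under [] [] (IH ≤-refl c (≤-trans (m≤m+n (edges c) 0) (s≤s⁻¹ size)))
    universal (suc n) IH n≤ (node (c₁ ∷ c₂ ∷ rest)) size with ≤-total (edges c₁) (edges c₂)
    ... | inj₁ c₁≤c₂ = spine-smallest-child (suc n) IH n≤ c₁ _ (smaller-child-bound c₁ c₂ rest c₁≤c₂ size) size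
    ... | inj₂ c₂≤c₁ =
      spine-smallest-child (suc n) IH n≤ c₂ _ (smaller-child-bound c₂ c₁ rest c₂≤c₁ size′) size′ ◅◅
      swap [] c₂ c₁ rest ◅ ε
      where
      size′ : edgesL (c₂ ∷ c₁ ∷ rest) ≤ suc n
      size′ = subst (_≤ suc n) (edgesL-swap c₁ c₂ rest) size

table-universal : ∀ F → (∀ i → 1 ≤ i → InF i (F i)) →
  ∀ N (i : Fin (suc N)) → UniversalUpTo (lookup (table F N) i) (toℕ i)
table-universal F F∈F zero    zero = universalUpTo-0 leaf
table-universal F F∈F (suc N) =
  lookup-∷ʳ-pointwise UniversalUpTo (table F N) _ (table-universal F F∈F N)
    (Spine.spine-universal N (table F N) (table-universal F F∈F N) (F (suc N)) (F∈F (suc N) (s≤s z≤n))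
      (suc N) ≤-refl)

theorem5 : (F : ℕ → ℕ → ℕ) →
    (∀ i → 1 ≤ i → InF i (F i)) →
    (∀ i → 1 ≤ i → ∀ k → 1 ≤ k → k ≤ i → F i k ≤ F (suc i) k) →
    ∀ m → 1 ≤ m → StronglyUniversal m (TreeF F m)
theorem5 F F∈F _ m _ T size =
  subst (UniversalUpTo (TreeF F m)) (toℕ-fromℕ m) (table-universal F F∈F m (fromℕ m)) T (≤-reflexive size)
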